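{- For all integers $s,t>1$, \[ \frac{2K(s,t)}{K(s,t-1)}\le R(s,t)<\frac{3K(s,t)}{K(s,t-1)}. \]
   Context: For positive integers $s,t$: $K(1,t)=2$, $K'(1,t)=5$; $K(s,1)=2^s$, $K'(s,1)=2^s+3$; and for $s,t>1$, $K(s,t)=K(s,t-1)\,K(s-1,K'(s,t-1))$ and $K'(s,t)=K'(s,t-1)\,K(s-1,K'(s,t-1))+K'(s-1,K'(s,t-1))$. Further $R(1,t)=0$ for all $t$, $R(s,1)=0$ for all $s$, and $R(s,t)=2K(s-1,K'(s,t-1))+R(s-1,K'(s,t-1))$ for $s,t>1$. -}

module Defs where

open import Data.Nat using (ℕ; zero; suc; _+_; _*_; _^_)

-- K and K' as in the paper, for positive integers s, t.
-- Argument 0 is outside the paper's domain; those clauses are junk values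
-- never used for s, t ≥ 1.
mutual
  K : ℕ → ℕ → ℕ
  K zero t = 0
  K (suc zero) t = 2
  K (suc (suc s)) zero = 0
  K (suc (suc s)) (suc zero) = 2 ^ suc (suc s)
  K (suc (suc s)) (suc (suc t)) =
    K (suc (suc s)) (suc t) * K (suc s) (K' (suc (suc s)) (suc t))

  K' : ℕ → ℕ → ℕ
  K' zero t = 0
  K' (suc zero) t = 5
  K' (suc (suc s)) zero = 0
  K' (suc (suc s)) (suc zero) = 2 ^ suc (suc s) + 3
  K' (suc (suc s)) (suc (suc t)) =
    K' (suc (suc s)) (suc t) * K (suc s) (K' (suc (suc s)) (suc t))
    + K' (suc s) (K' (suc (suc s)) (suc t))

R : ℕ → ℕ → ℕ
R zero t = 0
R (suc zero) t = 0
R (suc (suc s)) zero = 0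
R (suc (suc s)) (suc zero) = 0
R (suc (suc s)) (suc (suc t)) =
  2 * K (suc s) (K' (suc (suc s)) (suc t)) + R (suc s) (K' (suc (suc s)) (suc t))

{-# OPTIONS --safe #-}
-- Put k = K(s-1, K'(s,t-1)). One step of the recursions gives K(s,t) = K(s,t-1) · k
-- and R(s,t) = 2k + R(s-1, K'(s,t-1)), so after cancelling K(s,t-1) the theorem says
-- 0 ≤ R(s-1, K'(s,t-1)) < k. This is an instance of the invariant R < K, which the
-- recursion preserves: R < K at level s-1 gives R(s,t) < 3k, and K(s,t-1) ≥ 4 gives
-- 3k < K(s,t).
module Submission where

open import Defs
open import Data.Nat using (ℕ; zero; suc; _+_; _*_; _∸_; _≤_; _<_; z≤n; s≤s; z<s; >-nonZero)
open import Data.Nat.Properties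
open import Data.Product using (_×_; _,_)
open import Relation.Binary.PropositionalEquality using (cong)

0<K' : ∀ s t → 0 < t → 0 < K' (suc s) t
0<K' zero    t             _ = z<s
0<K' (suc s) (suc zero)    _ = <-≤-trans z<s (m≤n+m 3 _)
0<K' (suc s) (suc (suc t)) _ =
  ≤-trans (0<K' s _ (0<K' (suc s) (suc t) z<s)) (m≤n+m _ _)

2≤K : ∀ s t → 0 < t → 2 ≤ K (suc s) t
2≤K zero    t             _ = ≤-refl
2≤K (suc s) (suc zero)    _ = ^-monoʳ-≤ 2 {1} {suc (suc s)} (s≤s z≤n)
2≤K (suc s) (suc (suc t)) _ =
  ≤-trans (m≤m*n 2 2)
    (*-mono-≤ (2≤K (suc s) (suc t) z<s) (2≤K s _ (0<K' (suc s) (suc t) z<s)))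

4≤K : ∀ s t → 0 < t → 4 ≤ K (suc (suc s)) t
4≤K s (suc zero)    _ = ^-monoʳ-≤ 2 {2} {suc (suc s)} (s≤s (s≤s z≤n))
4≤K s (suc (suc t)) _ =
  *-mono-≤ (2≤K (suc s) (suc t) z<s) (2≤K s _ (0<K' (suc s) (suc t) z<s))

2*k+r<3*k : ∀ k {r} → r < k → 2 * k + r < 3 * k
2*k+r<3*k k {r} r<k = begin-strict
  2 * k + r  <⟨ +-monoʳ-< (2 * k) r<k ⟩
  2 * k + k  ≡⟨ +-comm (2 * k) k ⟩
  3 * k      ∎
  where open ≤-Reasoning

R<K : ∀ s t → 0 < t → R (suc s) t < K (suc s) t
R<K zero    t             _ = z<s
R<K (suc s) (suc zero)    _ = m^n>0 2 (suc (suc s))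
R<K (suc s) (suc (suc t)) _ = begin-strict
  2 * k + R (suc s) x  <⟨ 2*k+r<3*k k (R<K s x (0<K' (suc s) (suc t) z<s)) ⟩
  3 * k                ≤⟨ *-monoˡ-≤ k (≤-trans (n≤1+n 3) (4≤K s (suc t) z<s)) ⟩
  K (suc (suc s)) (suc t) * k ∎
  where
    open ≤-Reasoning
    x : ℕ
    x = K' (suc (suc s)) (suc t)
    k : ℕ
    k = K (suc s) x

2*[a*k]≤[2*k+r]*a<3*[a*k] : ∀ a k {r} → 0 < a → r < k →
  (2 * (a * k) ≤ (2 * k + r) * a) × ((2 * k + r) * a < 3 * (a * k))
2*[a*k]≤[2*k+r]*a<3*[a*k] a k {r} 0<a r<k = lower , upper
  where
    open ≤-Reasoning
    lower : 2 * (a * k) ≤ (2 * k + r) * a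
    lower = begin
      2 * (a * k)    ≡⟨ cong (2 *_) (*-comm a k) ⟩
      2 * (k * a)    ≡⟨ *-assoc 2 k a ⟨
      2 * k * a      ≤⟨ *-monoˡ-≤ a (m≤m+n (2 * k) r) ⟩
      (2 * k + r) * a ∎
    upper : (2 * k + r) * a < 3 * (a * k)
    upper = begin-strict
      (2 * k + r) * a  <⟨ *-monoˡ-< a {{>-nonZero 0<a}} (2*k+r<3*k k r<k) ⟩
      3 * k * a        ≡⟨ *-assoc 3 k a ⟩
      3 * (k * a)      ≡⟨ cong (3 *_) (*-comm k a) ⟩
      3 * (a * k)      ∎

mainTheorem9 : (s t : ℕ) → 1 < s → 1 < t →
    (2 * K s t ≤ R s t * K s (t ∸ 1)) × (R s t * K s (t ∸ 1) < 3 * K s t)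
mainTheorem9 (suc zero)    _             (s≤s ()) _
mainTheorem9 _             (suc zero)    _        (s≤s ())
mainTheorem9 (suc (suc s)) (suc (suc t)) _        _ =
  2*[a*k]≤[2*k+r]*a<3*[a*k] (K (suc (suc s)) (suc t)) _
    (≤-trans z<s (4≤K s (suc t) z<s))
    (R<K s _ (0<K' (suc s) (suc t) z<s))
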